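{- Let $M=(E,r_M)$ be a $q$-matroid, $E'\ge E$ with $\dim E'=\dim E+1$, and $\mu$ a modular cut selector of $M$. Let $r_\mu:\mathcal{L}(E')\to\mathbb{Z}_{\ge0}$ be defined by $r_\mu(X)=r_M(X)$ and $r_\mu(X+e)=r_M(X)+\delta_{X,e}$ for all $X\in\mathcal{L}(E)$ and $e\in[E']_q\setminus[E]_q$, where $\delta_{X,e}=0$ if $\mathrm{cl}_M(X)\in\mu(e)$ and $1$ otherwise. Then for all $Z_1,Z_2\in\mathcal{L}(E')$, $r_\mu(Z_1+Z_2)+r_\mu(Z_1\cap Z_2)\le r_\mu(Z_1)+r_\mu(Z_2)$.
   Context: $q$ is a prime power. For a finite-dimensional $\mathbb{F}_q$-vector space $E$, $\mathcal{L}(E)$ is the set of subspaces and $[E]_q$ the set of one-dimensional subspaces. A $q$-matroid is a pair $(E,r)$ with $r:\mathcal{L}(E)\to\mathbb{Z}_{\ge0}$ satisfying (R1) $0\le r(X)\le\dim X$; (R2) $X\le Y\Rightarrow r(X)\le r(Y)$; (R3) $r(X+Y)+r(X\cap Y)\le r(X)+r(Y)$. Closure: $\mathrm{cl}_M(X)=\sum\{x\in[E]_q: r(X+x)=r(X)\}$. Flats: subspaces $F$ with $r(F+x)>r(F)$ for all $x\in[E]_q\setminus[F]_q$; $\mathcal{F}_M$ the set of flats. Modular pair: flats $F_1,F_2$ with $r(F_1+F_2)+r(F_1\cap F_2)=r(F_1)+r(F_2)$. Modular cut: $\mathcal{M}\subseteq\mathcal{F}_M$ closed upward in $\mathcal{F}_M$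 and closed under intersection of modular pairs; $\mathrm{MC}_M$ the set of modular cuts. A modular cut selector is a function $\mu:[E']_q\setminus[E]_q\to\mathrm{MC}_M$ such that for all $e_1,e_2\in[E']_q\setminus[E]_q$ and $F\in\mu(e_1)$: $F+e_1=F+e_2$ iff $F\in\mu(e_2)$. -}

module Defs where

open import Data.Nat using (ℕ; zero; suc; _≤_; _<_) renaming (_+_ to _+ℕ_)
open import Data.Fin using (Fin) renaming (zero to fz; suc to fs)
open import Data.Vec using (Vec; zipWith; map; replicate)
open import Data.List using (List; []; _∷_)
open import Data.List.Membership.Propositional using (_∈_)
open import Data.List.Relation.Unary.All using (All)
open import Data.Product using (Σ; _×_; _,_; ∃)
open import Data.Sum using (_⊎_)
open import Relation.Nullary using (¬_)
open import Relation.Binary.PropositionalEquality using (_≡_)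
open import Algebra.Structures using (IsCommutativeRing)

-- A finite field (equality is propositional equality on the carrier).
-- A finite field has prime-power order q, so this covers exactly the
-- fields F_q of the paper.

record FiniteField : Set₁ where
  field
    K        : Set
    _+_ _*_  : K → K → K
    -_       : K → K
    0# 1#    : K
    isCommutativeRing : IsCommutativeRing _≡_ _+_ _*_ -_ 0# 1#
    0≢1      : ¬ (0# ≡ 1#)
    inv      : (x : K) → ¬ (x ≡ 0#) → K
    inv-r    : (x : K) (p : ¬ (x ≡ 0#)) → x * inv x p ≡ 1#
    elements : List K
    complete : (x : K) → x ∈ elements

-- Linear algebra in K^m.  A "set of vectors" is a predicate; subspaces
-- are predicates satisfying IsSubspace, compared extensionally (_≐_).

module VS (𝔽 : FiniteField) (m : ℕ) where
  open FiniteField 𝔽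

  V : Set
  V = Vec K m

  Pred : Set₁
  Pred = V → Set

  0ᵥ : V
  0ᵥ = replicate m 0#

  _+ᵥ_ : V → V → V
  _+ᵥ_ = zipWith _+_

  _·ᵥ_ : K → V → V
  c ·ᵥ v = map (c *_) v

  IsSubspace : Pred → Set
  IsSubspace P = P 0ᵥ
               × (∀ u v → P u → P v → P (u +ᵥ v))
               × (∀ c v → P v → P (c ·ᵥ v))

  _⊆_ : Pred → Pred → Set
  X ⊆ Y = ∀ v → X v → Y v

  _≐_ : Pred → Pred → Set
  X ≐ Y = X ⊆ Y × Y ⊆ X

  lincomb : List (K × V) → V
  lincomb []             = 0ᵥ
  lincomb ((c , v) ∷ l)  = (c ·ᵥ v) +ᵥ lincomb l

  Span : Pred → Pred
  Span S v = Σ (List (K × V)) λ l →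
               All (λ p → S (Data.Product.proj₂ p)) l × v ≡ lincomb l

  _⊕_ : Pred → Pred → Pred
  X ⊕ Y = Span (λ v → X v ⊎ Y v)

  _∩_ : Pred → Pred → Pred
  X ∩ Y = λ v → X v × Y v

  ⟨_⟩ : V → Pred
  ⟨ e ⟩ = Span (λ v → v ≡ e)

  lincombF : {d : ℕ} → (Fin d → K) → (Fin d → V) → V
  lincombF {zero}  c b = 0ᵥ
  lincombF {suc d} c b = (c fz ·ᵥ b fz) +ᵥ lincombF (λ i → c (fs i)) (λ i → b (fs i))

  HasDim : Pred → ℕ → Set
  HasDim X d = Σ (Fin d → V) λ b →
                 (∀ i → X (b i))
               × (∀ (c : Fin d → K) → lincombF c b ≡ 0ᵥ → ∀ i → c i ≡ 0#)
               × (∀ v → X v → Σ (Fin d → K) λ c → v ≡ lincombF c b)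

  -- The rank function is a map on
  -- predicates; only its values on subspaces of E matter, and it must be
  -- well defined on subspaces (invariant under extensional equality).

  SubOf : Pred → Pred → Set
  SubOf E X = IsSubspace X × X ⊆ E

  RespectsEq : (Pred → Set) → (Pred → ℕ) → Set₁
  RespectsEq L r = ∀ X Y → L X → L Y → X ≐ Y → r X ≡ r Y

  record IsQMatroid (E : Pred) (r : Pred → ℕ) : Set₁ where
    field
      well-def : RespectsEq (SubOf E) r
      R1 : ∀ X d → SubOf E X → HasDim X d → r X ≤ d
      R2 : ∀ X Y → SubOf E X → SubOf E Y → X ⊆ Y → r X ≤ r Y
      R3 : ∀ X Y → SubOf E X → SubOf E Y →
             r (X ⊕ Y) +ℕ r (X ∩ Y) ≤ r X +ℕ r Y

  -- one-dimensional subspaces of E are ⟨x⟩ with x ∈ E, x ≠ 0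
  IsPointOf : Pred → V → Set
  IsPointOf E x = E x × ¬ (x ≡ 0ᵥ)

  cl : Pred → (Pred → ℕ) → Pred → Pred
  cl E r X = Span (λ x → IsPointOf E x × r (X ⊕ ⟨ x ⟩) ≡ r X)

  IsFlat : Pred → (Pred → ℕ) → Pred → Set
  IsFlat E r F = SubOf E F × (∀ x → IsPointOf E x → ¬ F x → r F < r (F ⊕ ⟨ x ⟩))

  IsModularPair : (Pred → ℕ) → Pred → Pred → Set
  IsModularPair r F₁ F₂ = r (F₁ ⊕ F₂) +ℕ r (F₁ ∩ F₂) ≡ r F₁ +ℕ r F₂

  record IsModularCut (E : Pred) (r : Pred → ℕ) (𝓜 : Pred → Set) : Set₁ where
    field
      flats   : ∀ F → 𝓜 F → IsFlat E r F
      upward  : ∀ F G → 𝓜 F → IsFlat E r G → F ⊆ G → 𝓜 G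
      modular : ∀ F₁ F₂ → 𝓜 F₁ → 𝓜 F₂ → IsModularPair r F₁ F₂ → 𝓜 (F₁ ∩ F₂)

  -- modular cut selector: points e of E' = K^m not in E are ⟨e⟩ with e ∉ E
  -- (such e is automatically nonzero when E is a subspace)
  record IsModularCutSelector (E : Pred) (r : Pred → ℕ) (μ : V → Pred → Set) : Set₁ where
    field
      cut : ∀ e → ¬ E e → IsModularCut E r (μ e)
      sel : ∀ e₁ e₂ → ¬ E e₁ → ¬ E e₂ → ∀ F → μ e₁ F →
              ((F ⊕ ⟨ e₁ ⟩) ≐ (F ⊕ ⟨ e₂ ⟩) → μ e₂ F)
            × (μ e₂ F → (F ⊕ ⟨ e₁ ⟩) ≐ (F ⊕ ⟨ e₂ ⟩))

module Submission where

-- For a subspace Z of K^(n+1) that is not contained in the hyperplane E, Z = (Z ∩ E) ⊕ ⟨z⟩ for any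
-- z ∈ Z outside E, so rμ Z = r (Z ∩ E) + δ_{Z∩E,z}.  Submodularity of rμ therefore reduces to that of
-- r on the traces in E plus an inequality between δ's, in four cases according to which of Z₁, Z₂
-- and Z₁ ∩ Z₂ leave E.  The δ's are controlled by the modular cuts μ e: upward closure makes δ
-- decrease along inclusions; closure under modular pairs handles a common point e ∈ Z₁ ∩ Z₂ outside
-- E; and if Z₁, Z₂ leave E in different points a, b, the selector identity cl W ⊕ ⟨a⟩ = cl W ⊕ ⟨b⟩
-- (W the sum of the traces) puts the E-component of b into cl W.

open import Defs
open import Data.Nat as ℕ using (ℕ; zero; suc; z≤n; s≤s; _≤_; _<_) renaming (_+_ to _+ℕ_)
import Data.Nat.Properties as ℕP
open import Algebra.Properties.CommutativeSemigroup ℕP.+-commutativeSemigroup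
  using () renaming (interchange to +-interchange)
open import Data.Fin using (Fin; punchIn) renaming (zero to fz; suc to fs)
import Data.Fin.Properties as FinP
open import Data.Vec.Functional using (insertAt)
open import Data.Vec.Functional.Properties using (insertAt-lookup; insertAt-punchIn)
open import Data.Vec using (Vec; []; _∷_; zipWith; map; replicate; head; tail)
open import Data.Vec.Properties
  using (≡-dec; zipWith-assoc; zipWith-comm; zipWith-identityˡ; zipWith-identityʳ; zipWith-inverseʳ;
         map-cong; map-id; map-∘; map-const; map-replicate)
open import Data.Product using (Σ; _×_; _,_; proj₁; proj₂)
open import Data.Sum using (_⊎_; inj₁; inj₂)
open import Data.Empty using (⊥; ⊥-elim)
open import Data.List as List using (List; []; _∷_; _++_)
open import Data.List.Relation.Unary.All as All using (All; []; _∷_)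
import Data.List.Relation.Unary.All.Properties as AllP
open import Relation.Nullary using (¬_; Dec; yes; no; contradiction)
open import Relation.Nullary.Decidable using (decidable-stable; ¬¬-excluded-middle)
open import Relation.Nullary.Negation using (¬¬-map)
open import Data.List.Relation.Unary.Any using (here; there)
open import Data.List.Membership.Propositional using (_∈_; lose)
import Data.List.Membership.Propositional.Properties as ∈P
open import Relation.Binary.PropositionalEquality
  using (_≡_; refl; sym; trans; cong; cong₂; subst; subst₂; module ≡-Reasoning)
open import Algebra.Bundles using (CommutativeRing)
import Algebra.Properties.Ring as RingProperties
open import Level using (0ℓ)
open import Function using (_∘_)
open import Relation.Binary.Definitions using (DecidableEquality)

+-mono-≤-shifted : ∀ {x y s t u} k₁ k₂ → x ≤ k₁ +ℕ s → y ≤ k₂ +ℕ t → s +ℕ t ≤ u →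
                   x +ℕ y ≤ (k₁ +ℕ k₂) +ℕ u
+-mono-≤-shifted {x} {y} {s} {t} k₁ k₂ x≤ y≤ s+t≤u = begin
  x +ℕ y                     ≤⟨ ℕP.+-mono-≤ x≤ y≤ ⟩
  (k₁ +ℕ s) +ℕ (k₂ +ℕ t)     ≡⟨ +-interchange k₁ s k₂ t ⟩
  (k₁ +ℕ k₂) +ℕ (s +ℕ t)     ≤⟨ ℕP.+-monoʳ-≤ (k₁ +ℕ k₂) s+t≤u ⟩
  (k₁ +ℕ k₂) +ℕ _            ∎
  where open ℕP.≤-Reasoning

module VectorAlgebra (𝔽 : FiniteField) where
  open FiniteField 𝔽 using (K; isCommutativeRing; inv; inv-r)

  commutativeRing : CommutativeRing 0ℓ 0ℓ
  commutativeRing = record { isCommutativeRing = isCommutativeRing }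

  open CommutativeRing commutativeRing public
    using (_+_; _*_; -_; 0#; 1#; +-assoc; +-comm; +-identityˡ; +-identityʳ; -‿inverseʳ;
           *-assoc; *-comm; *-identityˡ; *-identityʳ; distribˡ; distribʳ; zeroˡ; zeroʳ)
  open RingProperties (CommutativeRing.ring commutativeRing) using (-1*x≈-x; -‿distribˡ-*)

  infixl 6 _+ᵥ_
  infixr 7 _·ᵥ_

  _+ᵥ_ : ∀ {m} → Vec K m → Vec K m → Vec K m
  _+ᵥ_ = zipWith _+_

  _·ᵥ_ : ∀ {m} → K → Vec K m → Vec K m
  c ·ᵥ v = map (c *_) v

  0ᵥ : ∀ {m} → Vec K m
  0ᵥ {m} = replicate m 0#

  +ᵥ-assoc : ∀ {m} (u v w : Vec K m) → (u +ᵥ v) +ᵥ w ≡ u +ᵥ (v +ᵥ w)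
  +ᵥ-assoc = zipWith-assoc +-assoc

  +ᵥ-comm : ∀ {m} (u v : Vec K m) → u +ᵥ v ≡ v +ᵥ u
  +ᵥ-comm = zipWith-comm +-comm

  +ᵥ-identityˡ : ∀ {m} (u : Vec K m) → 0ᵥ +ᵥ u ≡ u
  +ᵥ-identityˡ = zipWith-identityˡ +-identityˡ

  +ᵥ-identityʳ : ∀ {m} (u : Vec K m) → u +ᵥ 0ᵥ ≡ u
  +ᵥ-identityʳ = zipWith-identityʳ +-identityʳ

  +ᵥ-inverseʳ : ∀ {m} (u : Vec K m) → u +ᵥ (- 1#) ·ᵥ u ≡ 0ᵥ
  +ᵥ-inverseʳ u = trans (cong (u +ᵥ_) (map-cong -1*x≈-x u)) (zipWith-inverseʳ -‿inverseʳ u)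

  +ᵥ-swap : ∀ {m} (u v w : Vec K m) → u +ᵥ (v +ᵥ w) ≡ v +ᵥ (u +ᵥ w)
  +ᵥ-swap u v w = trans (sym (+ᵥ-assoc u v w)) (trans (cong (_+ᵥ w) (+ᵥ-comm u v)) (+ᵥ-assoc v u w))

  +ᵥ-interchange : ∀ {m} (u v w x : Vec K m) → (u +ᵥ v) +ᵥ (w +ᵥ x) ≡ (u +ᵥ w) +ᵥ (v +ᵥ x)
  +ᵥ-interchange u v w x =
    trans (+ᵥ-assoc u v _) (trans (cong (u +ᵥ_) (+ᵥ-swap v w x)) (sym (+ᵥ-assoc u w _)))

  +ᵥ-cancelʳ : ∀ {m} (u v : Vec K m) → (u +ᵥ v) +ᵥ (- 1#) ·ᵥ v ≡ u
  +ᵥ-cancelʳ u v = trans (+ᵥ-assoc u v _) (trans (cong (u +ᵥ_) (+ᵥ-inverseʳ v)) (+ᵥ-identityʳ u))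

  ·ᵥ-identityˡ : ∀ {m} (u : Vec K m) → 1# ·ᵥ u ≡ u
  ·ᵥ-identityˡ u = trans (map-cong *-identityˡ u) (map-id u)

  ·ᵥ-assoc : ∀ {m} a b (u : Vec K m) → (a * b) ·ᵥ u ≡ a ·ᵥ (b ·ᵥ u)
  ·ᵥ-assoc a b u = trans (map-cong (*-assoc a b) u) (map-∘ (a *_) (b *_) u)

  ·ᵥ-zeroˡ : ∀ {m} (u : Vec K m) → 0# ·ᵥ u ≡ 0ᵥ
  ·ᵥ-zeroˡ u = trans (map-cong zeroˡ u) (map-const u 0#)

  0·ᵥ-+ᵥ : ∀ {m} (u v : Vec K m) → 0# ·ᵥ u +ᵥ v ≡ v
  0·ᵥ-+ᵥ u v = trans (cong (_+ᵥ v) (·ᵥ-zeroˡ u)) (+ᵥ-identityˡ v)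

  ·ᵥ-zeroʳ : ∀ {m} c → c ·ᵥ 0ᵥ {m} ≡ 0ᵥ
  ·ᵥ-zeroʳ {m} c = trans (map-replicate (c *_) 0# m) (cong (replicate m) (zeroʳ c))

  ·ᵥ-distribˡ : ∀ {m} c (u v : Vec K m) → c ·ᵥ (u +ᵥ v) ≡ c ·ᵥ u +ᵥ c ·ᵥ v
  ·ᵥ-distribˡ c [] [] = refl
  ·ᵥ-distribˡ c (x ∷ u) (y ∷ v) = cong₂ _∷_ (distribˡ c x y) (·ᵥ-distribˡ c u v)

  ·ᵥ-distribʳ : ∀ {m} a b (u : Vec K m) → (a + b) ·ᵥ u ≡ a ·ᵥ u +ᵥ b ·ᵥ u
  ·ᵥ-distribʳ a b [] = refl
  ·ᵥ-distribʳ a b (x ∷ u) = cong₂ _∷_ (distribʳ x a b) (·ᵥ-distribʳ a b u)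

  +ᵥ≡0⇒≡-1·ᵥ : ∀ {m} (u v : Vec K m) → u +ᵥ v ≡ 0ᵥ → u ≡ (- 1#) ·ᵥ v
  +ᵥ≡0⇒≡-1·ᵥ u v u+v≡0 = begin
    u                          ≡⟨ sym (+ᵥ-cancelʳ u v) ⟩
    (u +ᵥ v) +ᵥ (- 1#) ·ᵥ v    ≡⟨ cong (_+ᵥ (- 1#) ·ᵥ v) u+v≡0 ⟩
    0ᵥ +ᵥ (- 1#) ·ᵥ v          ≡⟨ +ᵥ-identityˡ _ ⟩
    (- 1#) ·ᵥ v                ∎
    where open ≡-Reasoning

  ·ᵥ-solve : ∀ {m} a (a≢0 : ¬ a ≡ 0#) (u v : Vec K m) → a ·ᵥ u +ᵥ v ≡ 0ᵥ →
             u ≡ (inv a a≢0 * (- 1#)) ·ᵥ v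
  ·ᵥ-solve a a≢0 u v a·u+v≡0 = begin
    u                             ≡⟨ sym (·ᵥ-identityˡ u) ⟩
    1# ·ᵥ u                       ≡⟨ cong (_·ᵥ u) (sym (trans (*-comm a⁻¹ a) (inv-r a a≢0))) ⟩
    (a⁻¹ * a) ·ᵥ u                ≡⟨ ·ᵥ-assoc a⁻¹ a u ⟩
    a⁻¹ ·ᵥ (a ·ᵥ u)               ≡⟨ cong (a⁻¹ ·ᵥ_) (+ᵥ≡0⇒≡-1·ᵥ _ _ a·u+v≡0) ⟩
    a⁻¹ ·ᵥ ((- 1#) ·ᵥ v)          ≡⟨ sym (·ᵥ-assoc a⁻¹ _ v) ⟩
    (a⁻¹ * (- 1#)) ·ᵥ v           ∎
    where open ≡-Reasoning
          a⁻¹ = inv a a≢0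

  head-+ᵥ-·ᵥ : ∀ {m} (u v : Vec K (suc m)) c → head (u +ᵥ c ·ᵥ v) ≡ head u + c * head v
  head-+ᵥ-·ᵥ (x ∷ u) (y ∷ v) c = refl

  ·ᵥ-head-tail : ∀ {m} c (v : Vec K (suc m)) → c ·ᵥ v ≡ c * head v ∷ c ·ᵥ tail v
  ·ᵥ-head-tail c (x ∷ v) = refl

  combination : ∀ {m d} → (Fin d → K) → (Fin d → Vec K m) → Vec K m
  combination {d = zero}  c b = 0ᵥ
  combination {d = suc d} c b = c fz ·ᵥ b fz +ᵥ combination (c ∘ fs) (b ∘ fs)

  dot : ∀ {d} → (Fin d → K) → (Fin d → K) → K
  dot {zero}  c a = 0#
  dot {suc d} c a = c fz * a fz + dot (c ∘ fs) (a ∘ fs)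

  combination-cong : ∀ {m d} {c c′ : Fin d → K} {b : Fin d → Vec K m} →
                     (∀ i → c i ≡ c′ i) → combination c b ≡ combination c′ b
  combination-cong {d = zero}  c≗c′ = refl
  combination-cong {d = suc d} c≗c′ = cong₂ _+ᵥ_ (cong (_·ᵥ _) (c≗c′ fz)) (combination-cong (c≗c′ ∘ fs))

  dot-zeroʳ : ∀ {d} (c a : Fin d → K) → (∀ i → a i ≡ 0#) → dot c a ≡ 0#
  dot-zeroʳ {zero}  c a a≗0 = refl
  dot-zeroʳ {suc d} c a a≗0 =
    trans (cong₂ _+_ (trans (cong (c fz *_) (a≗0 fz)) (zeroʳ _)) (dot-zeroʳ _ _ (a≗0 ∘ fs)))
          (+-identityˡ 0#)

  combination-punchIn : ∀ {m k} (j : Fin (suc k)) (c : Fin (suc k) → K) (b : Fin (suc k) → Vec K m) →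
    combination c b ≡ c j ·ᵥ b j +ᵥ combination (c ∘ punchIn j) (b ∘ punchIn j)
  combination-punchIn fz c b = refl
  combination-punchIn {k = suc k} (fs j) c b =
    trans (cong (c fz ·ᵥ b fz +ᵥ_) (combination-punchIn j (c ∘ fs) (b ∘ fs)))
          (+ᵥ-swap _ _ _)

  combination-∷ : ∀ {m d} (c : Fin d → K) (b : Fin d → Vec K (suc m)) →
                  combination c b ≡ dot c (head ∘ b) ∷ combination c (tail ∘ b)
  combination-∷ {d = zero}  c b = refl
  combination-∷ {d = suc d} c b
    rewrite ·ᵥ-head-tail (c fz) (b fz) | combination-∷ (c ∘ fs) (b ∘ fs) = refl

  combination-shift : ∀ {m d} (c : Fin d → K) (b : Fin d → Vec K m) (t : Fin d → K) (y : Vec K m) →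
                      combination c (λ i → b i +ᵥ t i ·ᵥ y) ≡ combination c b +ᵥ dot c t ·ᵥ y
  combination-shift {d = zero} c b t y = sym (trans (cong (0ᵥ +ᵥ_) (·ᵥ-zeroˡ y)) (+ᵥ-identityˡ _))
  combination-shift {d = suc d} c b t y = begin
      c fz ·ᵥ (b fz +ᵥ t fz ·ᵥ y) +ᵥ combination (c ∘ fs) (λ i → b (fs i) +ᵥ t (fs i) ·ᵥ y)
        ≡⟨ cong₂ _+ᵥ_ (·ᵥ-distribˡ (c fz) _ _) (combination-shift (c ∘ fs) (b ∘ fs) (t ∘ fs) y) ⟩
      (P +ᵥ c fz ·ᵥ (t fz ·ᵥ y)) +ᵥ (R +ᵥ dot (c ∘ fs) (t ∘ fs) ·ᵥ y)
        ≡⟨ cong (λ u → (P +ᵥ u) +ᵥ (R +ᵥ dot (c ∘ fs) (t ∘ fs) ·ᵥ y)) (·ᵥ-assoc _ _ y) ⟨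
      (P +ᵥ (c fz * t fz) ·ᵥ y) +ᵥ (R +ᵥ dot (c ∘ fs) (t ∘ fs) ·ᵥ y)
        ≡⟨ +ᵥ-interchange P _ R _ ⟩
      (P +ᵥ R) +ᵥ ((c fz * t fz) ·ᵥ y +ᵥ dot (c ∘ fs) (t ∘ fs) ·ᵥ y)
        ≡⟨ cong ((P +ᵥ R) +ᵥ_) (·ᵥ-distribʳ _ _ y) ⟨
      (P +ᵥ R) +ᵥ dot c t ·ᵥ y ∎
    where
      open ≡-Reasoning
      P = c fz ·ᵥ b fz
      R = combination (c ∘ fs) (b ∘ fs)

module Elimination (𝔽 : FiniteField) (_≟_ : DecidableEquality (FiniteField.K 𝔽)) where
  open FiniteField 𝔽 using (K; inv; inv-r; 0≢1)
  open VectorAlgebra 𝔽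
  open RingProperties (CommutativeRing.ring commutativeRing) using (-‿distribˡ-*)

  Dependent : ∀ {m k} → (Fin k → Vec K m) → Set
  Dependent {k = k} w = Σ (Fin k → K) λ c → (Σ (Fin k) λ i → ¬ c i ≡ 0#) × combination c w ≡ 0ᵥ

  pivot-cancels : ∀ h a (a≢0 : ¬ a ≡ 0#) → h + (- (h * inv a a≢0)) * a ≡ 0#
  pivot-cancels h a a≢0 = begin
    h + (- (h * a⁻¹)) * a   ≡⟨ cong (h +_) (sym (-‿distribˡ-* (h * a⁻¹) a)) ⟩
    h + - ((h * a⁻¹) * a)   ≡⟨ cong (λ u → h + - u) (*-assoc h a⁻¹ a) ⟩
    h + - (h * (a⁻¹ * a))   ≡⟨ cong (λ u → h + - (h * u)) (trans (*-comm a⁻¹ a) (inv-r a a≢0)) ⟩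
    h + - (h * 1#)          ≡⟨ cong (λ u → h + - u) (*-identityʳ h) ⟩
    h + - h                 ≡⟨ -‿inverseʳ h ⟩
    0#                      ∎
    where open ≡-Reasoning
          a⁻¹ = inv a a≢0

  -- Gaussian elimination step: the pivot w j clears the first coordinate of the other vectors.
  dependent-by-pivot : ∀ {m k} (w : Fin (suc k) → Vec K (suc m)) (j : Fin (suc k)) (p : ¬ head (w j) ≡ 0#) →
    let t = λ i → - (head (w (punchIn j i)) * inv (head (w j)) p) in
    Dependent (λ i → tail (w (punchIn j i) +ᵥ t i ·ᵥ w j)) → Dependent w
  dependent-by-pivot {m} {k} w j p (c , (i₀ , cᵢ₀≢0) , c·tail-y≡0) =
    c̃ , (punchIn j i₀ , λ eq → cᵢ₀≢0 (trans (sym (insertAt-punchIn c j s i₀)) eq)) , c̃·w≡0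
    where
      t = λ i → - (head (w (punchIn j i)) * inv (head (w j)) p)
      y = λ i → w (punchIn j i) +ᵥ t i ·ᵥ w j
      s = dot c t
      c̃ = insertAt c j s
      head-y≡0 : ∀ i → head (y i) ≡ 0#
      head-y≡0 i = trans (head-+ᵥ-·ᵥ (w (punchIn j i)) (w j) (t i)) (pivot-cancels _ (head (w j)) p)
      c̃·w≡0 : combination c̃ w ≡ 0ᵥ
      c̃·w≡0 = begin
        combination c̃ w
          ≡⟨ combination-punchIn j c̃ w ⟩
        c̃ j ·ᵥ w j +ᵥ combination (c̃ ∘ punchIn j) (w ∘ punchIn j)
          ≡⟨ cong₂ _+ᵥ_ (cong (_·ᵥ w j) (insertAt-lookup c j s)) (combination-cong (insertAt-punchIn c j s)) ⟩
        s ·ᵥ w j +ᵥ combination c (w ∘ punchIn j)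
          ≡⟨ +ᵥ-comm _ _ ⟩
        combination c (w ∘ punchIn j) +ᵥ s ·ᵥ w j
          ≡⟨ combination-shift c (w ∘ punchIn j) t (w j) ⟨
        combination c y
          ≡⟨ combination-∷ c y ⟩
        dot c (head ∘ y) ∷ combination c (tail ∘ y)
          ≡⟨ cong₂ _∷_ (dot-zeroʳ c _ head-y≡0) c·tail-y≡0 ⟩
        0ᵥ ∎
        where open ≡-Reasoning

  dependent-if-more-vectors : ∀ {m k} → m < k → (w : Fin k → Vec K m) → Dependent w
  dependent-if-more-vectors {zero} {suc k} _ w =
    (λ _ → 1#) , (fz , 0≢1 ∘ sym) , empty (combination (λ _ → 1#) w)
    where empty : (v : Vec K 0) → v ≡ []
          empty [] = refl
  dependent-if-more-vectors {suc m} {suc k} (s≤s m<k) w with FinP.all? (λ i → head (w i) ≟ 0#)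
  ... | yes heads≡0 =
    let (c , nz , c·w≡0) = dependent-if-more-vectors (ℕP.m<n⇒m<1+n m<k) (tail ∘ w)
    in c , nz , trans (combination-∷ c w) (cong₂ _∷_ (dot-zeroʳ c _ heads≡0) c·w≡0)
  ... | no ¬heads≡0 =
    let (j , p) = FinP.¬∀⟶∃¬ _ (λ i → head (w i) ≡ 0#) (λ i → head (w i) ≟ 0#) ¬heads≡0
    in dependent-by-pivot w j p (dependent-if-more-vectors m<k _)

module Spans (𝔽 : FiniteField) (m : ℕ) where
  open FiniteField 𝔽 using (K)
  open VectorAlgebra 𝔽
  open VS 𝔽 m hiding (_+ᵥ_; _·ᵥ_; 0ᵥ)

  lincomb-++ : ∀ (l₁ l₂ : List (K × V)) → lincomb (l₁ ++ l₂) ≡ lincomb l₁ +ᵥ lincomb l₂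
  lincomb-++ []             l₂ = sym (+ᵥ-identityˡ _)
  lincomb-++ ((c , v) ∷ l₁) l₂ = trans (cong (c ·ᵥ v +ᵥ_) (lincomb-++ l₁ l₂)) (sym (+ᵥ-assoc _ _ _))

  scale : K → List (K × V) → List (K × V)
  scale a = List.map (λ (c , v) → a * c , v)

  lincomb-scale : ∀ a (l : List (K × V)) → lincomb (scale a l) ≡ a ·ᵥ lincomb l
  lincomb-scale a []            = sym (·ᵥ-zeroʳ a)
  lincomb-scale a ((c , v) ∷ l) =
    trans (cong₂ _+ᵥ_ (·ᵥ-assoc a c v) (lincomb-scale a l)) (sym (·ᵥ-distribˡ a _ _))

  All-scale : ∀ {S : Pred} a (l : List (K × V)) →
              All (S ∘ proj₂) l → All (S ∘ proj₂) (scale a l)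
  All-scale a []      []       = []
  All-scale a (_ ∷ l) (s ∷ ss) = s ∷ All-scale a l ss

  span-isSubspace : ∀ S → IsSubspace (Span S)
  span-isSubspace S =
      ([] , [] , refl)
    , (λ { u v (l₁ , s₁ , refl) (l₂ , s₂ , refl) → l₁ ++ l₂ , AllP.++⁺ s₁ s₂ , sym (lincomb-++ l₁ l₂) })
    , (λ { c v (l , s , refl) → scale c l , All-scale c l s , sym (lincomb-scale c l) })

  ⊆-span : ∀ {S} → S ⊆ Span S
  ⊆-span v s = ((1# , v) ∷ []) , (s ∷ []) , sym (trans (+ᵥ-identityʳ _) (·ᵥ-identityˡ v))

  span-least : ∀ {S W} → IsSubspace W → S ⊆ W → Span S ⊆ W
  span-least {S} {W} (w₀ , w₊ , w·) S⊆W v (l , s , refl) = closed l s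
    where
      closed : ∀ l → All (S ∘ proj₂) l → W (lincomb l)
      closed []            []       = w₀
      closed ((c , u) ∷ l) (s ∷ ss) = w₊ _ _ (w· c u (S⊆W u s)) (closed l ss)

  span-mono : ∀ {S T} → S ⊆ T → Span S ⊆ Span T
  span-mono {T = T} S⊆T = span-least (span-isSubspace T) (λ v s → ⊆-span v (S⊆T v s))

  ⊕-isSubspace : ∀ X Y → IsSubspace (X ⊕ Y)
  ⊕-isSubspace X Y = span-isSubspace _

  ⊆-⊕ˡ : ∀ {X Y} → X ⊆ (X ⊕ Y)
  ⊆-⊕ˡ v x = ⊆-span v (inj₁ x)

  ⊆-⊕ʳ : ∀ {X Y} → Y ⊆ (X ⊕ Y)
  ⊆-⊕ʳ v y = ⊆-span v (inj₂ y)

  ⊕-least : ∀ {X Y W} → IsSubspace W → X ⊆ W → Y ⊆ W → (X ⊕ Y) ⊆ W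
  ⊕-least sW X⊆W Y⊆W = span-least sW (λ { v (inj₁ x) → X⊆W v x ; v (inj₂ y) → Y⊆W v y })

  ⊆-refl : ∀ {X} → X ⊆ X
  ⊆-refl _ x = x

  ⊆-trans : ∀ {X Y Z} → X ⊆ Y → Y ⊆ Z → X ⊆ Z
  ⊆-trans X⊆Y Y⊆Z v = Y⊆Z v ∘ X⊆Y v

  ≐-trans : ∀ {X Y Z} → X ≐ Y → Y ≐ Z → X ≐ Z
  ≐-trans (X⊆Y , Y⊆X) (Y⊆Z , Z⊆Y) = ⊆-trans X⊆Y Y⊆Z , ⊆-trans Z⊆Y Y⊆X

  ⊕-mono : ∀ {X X′ Y Y′} → X ⊆ X′ → Y ⊆ Y′ → (X ⊕ Y) ⊆ (X′ ⊕ Y′)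
  ⊕-mono X⊆X′ Y⊆Y′ = ⊕-least (⊕-isSubspace _ _) (⊆-trans X⊆X′ ⊆-⊕ˡ) (⊆-trans Y⊆Y′ ⊆-⊕ʳ)

  ⊕-congˡ : ∀ {X X′ Y} → X ≐ X′ → (X ⊕ Y) ≐ (X′ ⊕ Y)
  ⊕-congˡ (X⊆X′ , X′⊆X) = ⊕-mono X⊆X′ ⊆-refl , ⊕-mono X′⊆X ⊆-refl

  ⊕-comm : ∀ X Y → (X ⊕ Y) ≐ (Y ⊕ X)
  ⊕-comm X Y = ⊕-least (⊕-isSubspace Y X) ⊆-⊕ʳ ⊆-⊕ˡ , ⊕-least (⊕-isSubspace X Y) ⊆-⊕ʳ ⊆-⊕ˡ

  ∩-mono : ∀ {X X′ Y Y′} → X ⊆ X′ → Y ⊆ Y′ → (X ∩ Y) ⊆ (X′ ∩ Y′)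
  ∩-mono X⊆X′ Y⊆Y′ v (x , y) = X⊆X′ v x , Y⊆Y′ v y

  ∩-comm : ∀ X Y → (X ∩ Y) ≐ (Y ∩ X)
  ∩-comm X Y = (λ _ (x , y) → y , x) , (λ _ (y , x) → x , y)

  ∩-isSubspace : ∀ {X Y} → IsSubspace X → IsSubspace Y → IsSubspace (X ∩ Y)
  ∩-isSubspace (x₀ , x₊ , x·) (y₀ , y₊ , y·) =
      (x₀ , y₀)
    , (λ u v (xu , yu) (xv , yv) → x₊ u v xu xv , y₊ u v yu yv)
    , (λ c v (xv , yv) → x· c v xv , y· c v yv)

  ∈⟨⟩ : ∀ e → ⟨ e ⟩ e
  ∈⟨⟩ e = ⊆-span e refl

  ⟨⟩-least : ∀ {e W} → IsSubspace W → W e → ⟨ e ⟩ ⊆ W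
  ⟨⟩-least sW w = span-least sW (λ { v refl → w })

  ⟨⟩-isSubspace : ∀ e → IsSubspace ⟨ e ⟩
  ⟨⟩-isSubspace e = span-isSubspace _

  +ᵥ·ᵥ-closed : ∀ {Z} → IsSubspace Z → ∀ {u v} c → Z u → Z v → Z (u +ᵥ c ·ᵥ v)
  +ᵥ·ᵥ-closed (_ , z₊ , z·) {u} {v} c zu zv = z₊ _ _ zu (z· c v zv)

  -ᵥ-closed : ∀ {Z} → IsSubspace Z → ∀ {u v} → Z u → Z v → Z (u +ᵥ (- 1#) ·ᵥ v)
  -ᵥ-closed (_ , z₊ , z·) {u} {v} zu zv = z₊ _ _ zu (z· _ v zv)

  Multiples : V → Pred
  Multiples e v = Σ K λ c → v ≡ c ·ᵥ e

  ⟨⟩-multiples : ∀ e → ⟨ e ⟩ ⊆ Multiples e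
  ⟨⟩-multiples e = ⟨⟩-least isSubspace (1# , sym (·ᵥ-identityˡ e))
    where
      isSubspace : IsSubspace (Multiples e)
      isSubspace = (0# , sym (·ᵥ-zeroˡ e))
                 , (λ { u v (a , refl) (b , refl) → a + b , sym (·ᵥ-distribʳ a b e) })
                 , (λ { c v (a , refl) → c * a , sym (·ᵥ-assoc c a e) })

  Translates : Pred → V → Pred
  Translates X e v = Σ V λ x → Σ K λ c → X x × v ≡ x +ᵥ c ·ᵥ e

  ⊕⟨⟩-translates : ∀ {X} e → IsSubspace X → (X ⊕ ⟨ e ⟩) ⊆ Translates X e
  ⊕⟨⟩-translates {X} e sX@(x₀ , x₊ , x·) =
    ⊕-least isSubspace
      (λ v x → v , 0# , x , sym (trans (cong (v +ᵥ_) (·ᵥ-zeroˡ e)) (+ᵥ-identityʳ v)))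
      (⟨⟩-least isSubspace (0ᵥ , 1# , x₀ , sym (trans (+ᵥ-identityˡ _) (·ᵥ-identityˡ e))))
    where
      isSubspace : IsSubspace (Translates X e)
      isSubspace =
          (0ᵥ , 0# , x₀ , sym (trans (+ᵥ-identityˡ _) (·ᵥ-zeroˡ e)))
        , (λ { u v (x₁ , c₁ , X₁ , refl) (x₂ , c₂ , X₂ , refl) →
               x₁ +ᵥ x₂ , c₁ + c₂ , x₊ _ _ X₁ X₂ ,
               trans (+ᵥ-interchange x₁ (c₁ ·ᵥ e) x₂ (c₂ ·ᵥ e))
                     (cong ((x₁ +ᵥ x₂) +ᵥ_) (sym (·ᵥ-distribʳ c₁ c₂ e))) })
        , (λ { a v (x , c , Xx , refl) → a ·ᵥ x , a * c , x· a x Xx ,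
               trans (·ᵥ-distribˡ a x _) (cong (a ·ᵥ x +ᵥ_) (sym (·ᵥ-assoc a c e))) })

module DecidableLinearAlgebra (𝔽 : FiniteField) (_≟_ : DecidableEquality (FiniteField.K 𝔽)) (m : ℕ) where
  open FiniteField 𝔽 using (K)
  open VectorAlgebra 𝔽
  open VS 𝔽 m hiding (_+ᵥ_; _·ᵥ_; 0ᵥ)
  open Spans 𝔽 m

  _≟ᵥ_ : DecidableEquality V
  _≟ᵥ_ = ≡-dec _≟_

  ⟨⟩-dimension : ∀ e → HasDim ⟨ e ⟩ 0 ⊎ HasDim ⟨ e ⟩ 1
  ⟨⟩-dimension e with e ≟ᵥ 0ᵥ
  ... | yes refl = inj₁ ((λ ()) , (λ ()) , (λ _ _ ()) , λ v v∈⟨0⟩ → (λ ()) , multiple-of-0 v v∈⟨0⟩)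
    where
      multiple-of-0 : ∀ v → ⟨ 0ᵥ ⟩ v → v ≡ 0ᵥ
      multiple-of-0 v v∈⟨0⟩ with ⟨⟩-multiples 0ᵥ v v∈⟨0⟩
      ... | c , refl = ·ᵥ-zeroʳ c
  ... | no e≢0 = inj₂ ((λ _ → e) , (λ _ → ∈⟨⟩ e) , independent , spanning)
    where
      independent : ∀ (c : Fin 1 → K) → lincombF c (λ _ → e) ≡ 0ᵥ → ∀ i → c i ≡ 0#
      independent c c·e≡0 fz with c fz ≟ 0#
      ... | yes c≡0 = c≡0
      ... | no c≢0  = ⊥-elim (e≢0 (trans (·ᵥ-solve _ c≢0 e 0ᵥ c·e≡0) (·ᵥ-zeroʳ _)))
      spanning : ∀ v → ⟨ e ⟩ v → Σ (Fin 1 → K) λ c → v ≡ lincombF c (λ _ → e)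
      spanning v v∈⟨e⟩ with ⟨⟩-multiples e v v∈⟨e⟩
      ... | c , refl = (λ _ → c) , sym (+ᵥ-identityʳ _)

  ⊕⟨⟩-∩-⊆ : ∀ {E F e} → IsSubspace E → SubOf E F → ¬ E e → ((F ⊕ ⟨ e ⟩) ∩ E) ⊆ F
  ⊕⟨⟩-∩-⊆ {E} {F} {e} sE (sF , F⊆E) e∉E v (v∈F⊕e , v∈E) with ⊕⟨⟩-translates e sF v v∈F⊕e
  ... | f , c , f∈F , refl with c ≟ 0#
  ...   | yes refl = subst F (sym (trans (cong (f +ᵥ_) (·ᵥ-zeroˡ e)) (+ᵥ-identityʳ f))) f∈F
  ...   | no c≢0   = ⊥-elim (e∉E (subst E (sym (·ᵥ-solve c c≢0 e q c·e+q≡0))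
                                         (proj₂ (proj₂ sE) _ q (-ᵥ-closed sE (F⊆E f f∈F) v∈E))))
    where
      q = f +ᵥ (- 1#) ·ᵥ (f +ᵥ c ·ᵥ e)
      c·e+q≡0 : c ·ᵥ e +ᵥ q ≡ 0ᵥ
      c·e+q≡0 = trans (sym (+ᵥ-assoc _ f _))
                      (trans (cong (_+ᵥ (- 1#) ·ᵥ (f +ᵥ c ·ᵥ e)) (+ᵥ-comm _ f)) (+ᵥ-inverseʳ _))

module Hyperplane (𝔽 : FiniteField) (_≟_ : DecidableEquality (FiniteField.K 𝔽)) (n : ℕ)
                  (E : VS.Pred 𝔽 (suc n)) (sE : VS.IsSubspace 𝔽 (suc n) E)
                  (dimE : VS.HasDim 𝔽 (suc n) E n) where
  open FiniteField 𝔽 using (K; inv)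
  open VectorAlgebra 𝔽
  open VS 𝔽 (suc n) hiding (_+ᵥ_; _·ᵥ_; 0ᵥ)
  open Spans 𝔽 (suc n)
  open Elimination 𝔽 _≟_

  lincombF≡combination : ∀ {d} (c : Fin d → K) (b : Fin d → V) → lincombF c b ≡ combination c b
  lincombF≡combination {zero}  c b = refl
  lincombF≡combination {suc d} c b = cong (c fz ·ᵥ b fz +ᵥ_) (lincombF≡combination (c ∘ fs) (b ∘ fs))

  combination-closed : ∀ {d S} → IsSubspace S → (c : Fin d → K) (b : Fin d → V) →
                       (∀ i → S (b i)) → S (combination c b)
  combination-closed {zero}  (s₀ , _ , _) c b b∈S = s₀
  combination-closed {suc d} sS@(_ , s₊ , s·) c b b∈S =
    s₊ _ _ (s· (c fz) (b fz) (b∈S fz)) (combination-closed sS (c ∘ fs) (b ∘ fs) (b∈S ∘ fs))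

  -- v, z and a basis of E are n + 2 vectors in K^(n+1); a dependency among them must involve
  -- v (the basis is independent and z ∉ E), which expresses v through E and z.
  hyperplane-split : ∀ {z} → ¬ E z → ∀ v → Translates E z v
  hyperplane-split {z} z∉E v with dependent-if-more-vectors (ℕP.n<1+n (suc n)) w
    where
      w : Fin (suc (suc n)) → V
      w fz           = v
      w (fs fz)      = z
      w (fs (fs i))  = proj₁ dimE i
  ... | c , nz , c·w≡0 = g ·ᵥ L , g * c (fs fz) , proj₂ (proj₂ sE) g L L∈E , v≡
    where
      b = proj₁ dimE
      b∈E = proj₁ (proj₂ dimE)
      independent = proj₁ (proj₂ (proj₂ dimE))
      L = combination (c ∘ fs ∘ fs) b
      L∈E = combination-closed sE _ b b∈E

      no-dependency-without-v : c (fs fz) ·ᵥ z +ᵥ L ≡ 0ᵥ → c fz ≡ 0# → ⊥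
      no-dependency-without-v c₁·z+L≡0 c₀≡0 with c (fs fz) ≟ 0#
      ... | no c₁≢0  = z∉E (subst E (sym (·ᵥ-solve _ c₁≢0 z L c₁·z+L≡0)) (proj₂ (proj₂ sE) _ L L∈E))
      ... | yes c₁≡0 = proj₂ nz (all-zero (proj₁ nz))
        where
          L≡0 : L ≡ 0ᵥ
          L≡0 = trans (sym (0·ᵥ-+ᵥ z L)) (subst (λ a → a ·ᵥ z +ᵥ L ≡ 0ᵥ) c₁≡0 c₁·z+L≡0)
          all-zero : ∀ i → c i ≡ 0#
          all-zero fz           = c₀≡0
          all-zero (fs fz)      = c₁≡0
          all-zero (fs (fs i))  = independent (c ∘ fs ∘ fs) (trans (lincombF≡combination _ b) L≡0) i

      c₀≢0 : ¬ c fz ≡ 0#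
      c₀≢0 c₀≡0 = no-dependency-without-v (trans (sym (0·ᵥ-+ᵥ v R)) (subst (λ a → a ·ᵥ v +ᵥ R ≡ 0ᵥ) c₀≡0 c·w≡0)) c₀≡0
        where R = c (fs fz) ·ᵥ z +ᵥ L

      g = inv (c fz) c₀≢0 * (- 1#)
      v≡ : v ≡ g ·ᵥ L +ᵥ (g * c (fs fz)) ·ᵥ z
      v≡ = begin
        v                                      ≡⟨ ·ᵥ-solve (c fz) c₀≢0 v _ c·w≡0 ⟩
        g ·ᵥ (c (fs fz) ·ᵥ z +ᵥ L)             ≡⟨ ·ᵥ-distribˡ g _ L ⟩
        g ·ᵥ (c (fs fz) ·ᵥ z) +ᵥ g ·ᵥ L        ≡⟨ +ᵥ-comm _ _ ⟩
        g ·ᵥ L +ᵥ g ·ᵥ (c (fs fz) ·ᵥ z)        ≡⟨ cong (g ·ᵥ L +ᵥ_) (·ᵥ-assoc g _ z) ⟨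
        g ·ᵥ L +ᵥ (g * c (fs fz)) ·ᵥ z         ∎
        where open ≡-Reasoning

  ≐-∩⊕⟨⟩ : ∀ {Z z} → IsSubspace Z → Z z → ¬ E z → Z ≐ ((Z ∩ E) ⊕ ⟨ z ⟩)
  ≐-∩⊕⟨⟩ {Z} {z} sZ z∈Z z∉E = split , ⊕-least sZ (λ v → proj₁) (⟨⟩-least sZ z∈Z)
    where
      split : Z ⊆ ((Z ∩ E) ⊕ ⟨ z ⟩)
      split v v∈Z with hyperplane-split z∉E v
      ... | x , d , x∈E , refl = proj₁ (proj₂ (⊕-isSubspace _ _)) x (d ·ᵥ z)
                                   (⊆-⊕ˡ x (x∈Z , x∈E))
                                   (⊆-⊕ʳ _ (proj₂ (proj₂ (⟨⟩-isSubspace z)) d z (∈⟨⟩ z)))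
        where
          x∈Z : Z x
          x∈Z = subst Z (+ᵥ-cancelʳ x (d ·ᵥ z)) (-ᵥ-closed sZ v∈Z (proj₂ (proj₂ sZ) d z z∈Z))

-- Equality on K is not assumed decidable, and neither are the predicates μ e.  All case
-- distinctions below are therefore made under a double negation, which is harmless because the
-- goal, an inequality of naturals, is decidable and hence ¬¬-stable.
module Classical where

  ¬¬-elim-≤ : ∀ {A : Set} {a b} → ¬ ¬ A → (A → a ≤ b) → a ≤ b
  ¬¬-elim-≤ {a = a} {b} ¬¬A A⇒a≤b = decidable-stable (a ℕ.≤? b) (λ a≰b → ¬¬A (a≰b ∘ A⇒a≤b))

  by-cases : ∀ {A : Set} {a b} → (A → a ≤ b) → (¬ A → a ≤ b) → a ≤ b
  by-cases yes-case no-case = ¬¬-elim-≤ ¬¬-excluded-middle λ { (yes a) → yes-case a ; (no ¬a) → no-case ¬a }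

  ¬¬-All : ∀ {A : Set} {P : A → Set} (xs : List A) → (∀ x → ¬ ¬ P x) → ¬ ¬ All P xs
  ¬¬-All []       ¬¬P k = k []
  ¬¬-All (x ∷ xs) ¬¬P k = ¬¬P x (λ px → ¬¬-All xs ¬¬P (λ pxs → k (px ∷ pxs)))

module Enumeration (𝔽 : FiniteField) where
  open FiniteField 𝔽 using (K; elements; complete)
  open Classical

  ¬¬-∀ : ∀ {P : K → Set} → (∀ x → ¬ ¬ P x) → ¬ ¬ (∀ x → P x)
  ¬¬-∀ ¬¬P k = ¬¬-All elements ¬¬P (λ all → k (λ x → All.lookup all (complete x)))

  ¬¬-∀ᵥ : ∀ m {P : Vec K m → Set} → (∀ v → ¬ ¬ P v) → ¬ ¬ (∀ v → P v)
  ¬¬-∀ᵥ zero    ¬¬P k = ¬¬P [] (λ p → k (λ { [] → p }))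
  ¬¬-∀ᵥ (suc m) ¬¬P k =
    ¬¬-∀ (λ x → ¬¬-∀ᵥ m (λ v → ¬¬P (x ∷ v))) (λ P∷ → k (λ { (x ∷ v) → P∷ x v }))

  ¬¬-decidableEquality : ¬ ¬ DecidableEquality K
  ¬¬-decidableEquality = ¬¬-∀ (λ x → ¬¬-∀ (λ y → ¬¬-excluded-middle))

  vectors : ∀ m → List (Vec K m)
  vectors zero    = [] ∷ []
  vectors (suc m) = List.concatMap (λ x → List.map (x ∷_) (vectors m)) elements

  ∈-vectors : ∀ m (v : Vec K m) → v ∈ vectors m
  ∈-vectors zero    []      = here refl
  ∈-vectors (suc m) (x ∷ v) =
    ∈P.∈-concatMap⁺ (λ y → List.map (y ∷_) (vectors m)) (lose (complete x) (∈P.∈-map⁺ (x ∷_) (∈-vectors m v)))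

module QMatroid (𝔽 : FiniteField) (_≟_ : DecidableEquality (FiniteField.K 𝔽)) (m : ℕ)
                (E : VS.Pred 𝔽 m) (sE : VS.IsSubspace 𝔽 m E)
                (r : VS.Pred 𝔽 m → ℕ) (qm : VS.IsQMatroid 𝔽 m E r) where
  open VectorAlgebra 𝔽
  open VS 𝔽 m hiding (_+ᵥ_; _·ᵥ_; 0ᵥ)
  open Spans 𝔽 m
  open DecidableLinearAlgebra 𝔽 _≟_ m
  open IsQMatroid qm
  open Classical
  open Enumeration 𝔽

  Sub : Pred → Set
  Sub = SubOf E

  E-sub : Sub E
  E-sub = sE , λ _ e → e

  ⊕-sub : ∀ {X Y} → Sub X → Sub Y → Sub (X ⊕ Y)
  ⊕-sub {X} {Y} (_ , X⊆E) (_ , Y⊆E) = ⊕-isSubspace X Y , ⊕-least sE X⊆E Y⊆E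

  ∩-subˡ : ∀ {X Y} → Sub X → IsSubspace Y → Sub (X ∩ Y)
  ∩-subˡ (sX , X⊆E) sY = ∩-isSubspace sX sY , λ v → X⊆E v ∘ proj₁

  ∩-subʳ : ∀ {X Y} → IsSubspace X → Sub Y → Sub (X ∩ Y)
  ∩-subʳ sX (sY , Y⊆E) = ∩-isSubspace sX sY , λ v → Y⊆E v ∘ proj₂

  ⟨⟩-sub : ∀ {e} → E e → Sub ⟨ e ⟩
  ⟨⟩-sub {e} e∈E = ⟨⟩-isSubspace e , ⟨⟩-least sE e∈E

  rank-cong : ∀ {X Y} → Sub X → Sub Y → X ≐ Y → r X ≡ r Y
  rank-cong = well-def _ _

  rank-mono : ∀ {X Y} → Sub X → Sub Y → X ⊆ Y → r X ≤ r Y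
  rank-mono = R2 _ _

  submodular : ∀ {X Y} → Sub X → Sub Y → r (X ⊕ Y) +ℕ r (X ∩ Y) ≤ r X +ℕ r Y
  submodular = R3 _ _

  rank-⊕-absorb : ∀ {A B X} → Sub A → Sub B → Sub X → X ⊆ A → X ⊆ B → r B ≤ r X → r (A ⊕ B) ≤ r A
  rank-⊕-absorb {A} {B} {X} sA sB sX X⊆A X⊆B rB≤rX =
    ℕP.+-cancelʳ-≤ (r X) (r (A ⊕ B)) (r A) (begin
      r (A ⊕ B) +ℕ r X        ≤⟨ ℕP.+-monoʳ-≤ (r (A ⊕ B)) (rank-mono sX (∩-subˡ sA (proj₁ sB)) X⊆A∩B) ⟩
      r (A ⊕ B) +ℕ r (A ∩ B)  ≤⟨ submodular sA sB ⟩
      r A +ℕ r B              ≤⟨ ℕP.+-monoʳ-≤ (r A) rB≤rX ⟩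
      r A +ℕ r X              ∎)
    where
      open ℕP.≤-Reasoning
      X⊆A∩B : X ⊆ (A ∩ B)
      X⊆A∩B v x = X⊆A v x , X⊆B v x

  rank-⟨⟩≤1 : ∀ {e} → E e → r ⟨ e ⟩ ≤ 1
  rank-⟨⟩≤1 {e} e∈E with ⟨⟩-dimension e
  ... | inj₁ dim0 = ℕP.≤-trans (R1 _ 0 (⟨⟩-sub e∈E) dim0) z≤n
  ... | inj₂ dim1 = R1 _ 1 (⟨⟩-sub e∈E) dim1

  rank-⊕⟨⟩≤suc : ∀ {W e} → Sub W → E e → r (W ⊕ ⟨ e ⟩) ≤ suc (r W)
  rank-⊕⟨⟩≤suc {W} {e} sW e∈E = begin
    r (W ⊕ ⟨ e ⟩)                       ≤⟨ ℕP.m≤m+n _ _ ⟩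
    r (W ⊕ ⟨ e ⟩) +ℕ r (W ∩ ⟨ e ⟩)      ≤⟨ submodular sW (⟨⟩-sub e∈E) ⟩
    r W +ℕ r ⟨ e ⟩                      ≤⟨ ℕP.+-monoʳ-≤ (r W) (rank-⟨⟩≤1 e∈E) ⟩
    r W +ℕ 1                            ≡⟨ ℕP.+-comm (r W) 1 ⟩
    suc (r W)                           ∎
    where open ℕP.≤-Reasoning

  Redundant : Pred → Pred
  Redundant X x = IsPointOf E x × r (X ⊕ ⟨ x ⟩) ≡ r X

  cl-sub : ∀ X → Sub (cl E r X)
  cl-sub X = span-isSubspace _ , span-least sE (λ v → proj₁ ∘ proj₁)

  ∈-cl : ∀ {X v} → Sub X → E v → r (X ⊕ ⟨ v ⟩) ≤ r X → cl E r X v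
  ∈-cl {X} {v} sX v∈E r≤ with v ≟ᵥ 0ᵥ
  ... | yes v≡0 = [] , [] , v≡0
  ... | no v≢0  = ⊆-span v ((v∈E , v≢0) , ℕP.≤-antisym r≤ (rank-mono sX (⊕-sub sX (⟨⟩-sub v∈E)) ⊆-⊕ˡ))

  ⊆-cl : ∀ {X} → Sub X → X ⊆ cl E r X
  ⊆-cl sX@(sX′ , X⊆E) v v∈X =
    ∈-cl sX (X⊆E v v∈X)
      (rank-mono (⊕-sub sX (⟨⟩-sub (X⊆E v v∈X))) sX (⊕-least sX′ ⊆-refl (⟨⟩-least sX′ v∈X)))

  cl-mono : ∀ {X Y} → Sub X → Sub Y → X ⊆ Y → cl E r X ⊆ cl E r Y
  cl-mono {X} {Y} sX sY X⊆Y = span-least (proj₁ (cl-sub Y)) redundant-over-Y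
    where
      redundant-over-Y : Redundant X ⊆ cl E r Y
      redundant-over-Y x ((x∈E , x≢0) , rX⊕x≡rX) = ⊆-span x ((x∈E , x≢0) , ℕP.≤-antisym
        (begin
          r (Y ⊕ ⟨ x ⟩)          ≤⟨ rank-mono (⊕-sub sY sx) (⊕-sub sY sX⊕x) (⊕-mono ⊆-refl ⊆-⊕ʳ) ⟩
          r (Y ⊕ (X ⊕ ⟨ x ⟩))    ≤⟨ rank-⊕-absorb sY sX⊕x sX X⊆Y ⊆-⊕ˡ (ℕP.≤-reflexive rX⊕x≡rX) ⟩
          r Y                    ∎)
        (rank-mono sY (⊕-sub sY sx) ⊆-⊕ˡ))
        where
          open ℕP.≤-Reasoning
          sx = ⟨⟩-sub x∈E
          sX⊕x = ⊕-sub sX sx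

  infix 25 _⊕[_]
  _⊕[_] : Pred → List V → Pred
  X ⊕[ ps ] = X ⊕ Span (_∈ ps)

  ⊕[]-sub : ∀ {X} → Sub X → ∀ {ps} → All E ps → Sub (X ⊕[ ps ])
  ⊕[]-sub sX ps∈E = ⊕-sub sX (span-isSubspace _ , span-least sE (λ u → All.lookup ps∈E))

  rank-⊕[redundant] : ∀ {X} → Sub X → ∀ ps → All (Redundant X) ps → r (X ⊕[ ps ]) ≤ r X
  rank-⊕[redundant] {X} sX [] [] =
    rank-mono (⊕[]-sub sX []) sX (⊕-least (proj₁ sX) ⊆-refl (span-least (proj₁ sX) (λ _ ())))
  rank-⊕[redundant] {X} sX (p ∷ ps) (((p∈E , _) , rX⊕p≡rX) ∷ red) = begin
    r (X ⊕[ p ∷ ps ])                ≤⟨ rank-mono (⊕[]-sub sX (p∈E ∷ ps∈E)) (⊕-sub sA sB) split ⟩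
    r ((X ⊕[ ps ]) ⊕ (X ⊕ ⟨ p ⟩))    ≤⟨ rank-⊕-absorb sA sB sX ⊆-⊕ˡ ⊆-⊕ˡ (ℕP.≤-reflexive rX⊕p≡rX) ⟩
    r (X ⊕[ ps ])                    ≤⟨ rank-⊕[redundant] sX ps red ⟩
    r X                              ∎
    where
      open ℕP.≤-Reasoning
      ps∈E = All.map (proj₁ ∘ proj₁) red
      sA = ⊕[]-sub sX ps∈E
      sB = ⊕-sub sX (⟨⟩-sub p∈E)
      split : X ⊕[ p ∷ ps ] ⊆ ((X ⊕[ ps ]) ⊕ (X ⊕ ⟨ p ⟩))
      split = ⊕-least (⊕-isSubspace _ _) (⊆-trans ⊆-⊕ˡ ⊆-⊕ˡ)
                (span-least (⊕-isSubspace _ _) λ { u (here refl) → ⊆-⊕ʳ u (⊆-⊕ʳ u (∈⟨⟩ u))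
                                                 ; u (there u∈ps) → ⊆-⊕ˡ u (⊆-⊕ʳ u (⊆-span u u∈ps)) })

  module _ {X : Pred} (cl? : ∀ v → Dec (cl E r X v)) where

    witness-points : ∀ {v} → Dec (cl E r X v) → List V
    witness-points (yes (l , _ , _)) = List.map proj₂ l
    witness-points (no _)            = []

    all-witness-points : List V → List V
    all-witness-points vs = List.concatMap (witness-points ∘ cl?) vs

    all-witness-points-redundant : ∀ vs → All (Redundant X) (all-witness-points vs)
    all-witness-points-redundant []       = []
    all-witness-points-redundant (v ∷ vs) = AllP.++⁺ (redundant (cl? v)) (all-witness-points-redundant vs)
      where
        redundant : ∀ {v} (d : Dec (cl E r X v)) → All (Redundant X) (witness-points d)
        redundant (yes (l , red , _)) = AllP.map⁺ red
        redundant (no _)              = []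

    span-all-witness-points : ∀ {vs v} → v ∈ vs → cl E r X v → Span (_∈ all-witness-points vs) v
    span-all-witness-points {w ∷ vs} (there v∈vs) v∈cl =
      span-mono (λ u → ∈P.∈-++⁺ʳ (witness-points (cl? w))) _ (span-all-witness-points v∈vs v∈cl)
    span-all-witness-points {v ∷ vs} (here refl) v∈cl with cl? v
    ... | yes (l , _ , v≡) = l , All.tabulate (λ p∈l → ∈P.∈-++⁺ˡ (∈P.∈-map⁺ proj₂ p∈l)) , v≡
    ... | no v∉cl          = contradiction v∈cl v∉cl

  rank-cl≤ : ∀ {X} → Sub X → r (cl E r X) ≤ r X
  rank-cl≤ {X} sX = ¬¬-elim-≤ (¬¬-∀ᵥ m (λ v → ¬¬-excluded-middle)) λ cl? →
    let ps = all-witness-points cl? (vectors m)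
        red = all-witness-points-redundant cl? (vectors m)
    in begin
      r (cl E r X)     ≤⟨ rank-mono (cl-sub X) (⊕[]-sub sX (All.map (proj₁ ∘ proj₁) red))
                            (λ v v∈cl → ⊆-⊕ʳ v (span-all-witness-points cl? (∈-vectors m v) v∈cl)) ⟩
      r (X ⊕[ ps ])    ≤⟨ rank-⊕[redundant] sX ps red ⟩
      r X              ∎
    where open ℕP.≤-Reasoning

  rank-cl : ∀ {X} → Sub X → r (cl E r X) ≡ r X
  rank-cl sX = ℕP.≤-antisym (rank-cl≤ sX) (rank-mono sX (cl-sub _) (⊆-cl sX))

  cl-isFlat : ∀ {X} → Sub X → IsFlat E r (cl E r X)
  cl-isFlat {X} sX = cl-sub X , λ x (x∈E , _) x∉cl → ℕP.≰⇒> λ r≤ → x∉cl (∈-cl sX x∈E (lift x∈E r≤))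
    where
      open ℕP.≤-Reasoning
      lift : ∀ {x} → E x → r (cl E r X ⊕ ⟨ x ⟩) ≤ r (cl E r X) → r (X ⊕ ⟨ x ⟩) ≤ r X
      lift x∈E r≤ = begin
        r (X ⊕ ⟨ _ ⟩)          ≤⟨ rank-mono (⊕-sub sX (⟨⟩-sub x∈E)) (⊕-sub (cl-sub X) (⟨⟩-sub x∈E))
                                    (⊕-mono (⊆-cl sX) ⊆-refl) ⟩
        r (cl E r X ⊕ ⟨ _ ⟩)   ≤⟨ r≤ ⟩
        r (cl E r X)           ≤⟨ rank-cl≤ sX ⟩
        r X                    ∎

module ModularCut (𝔽 : FiniteField) (_≟_ : DecidableEquality (FiniteField.K 𝔽)) (m : ℕ)
                  (E : VS.Pred 𝔽 m) (sE : VS.IsSubspace 𝔽 m E)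
                  (r : VS.Pred 𝔽 m → ℕ) (qm : VS.IsQMatroid 𝔽 m E r)
                  (𝓜 : VS.Pred 𝔽 m → Set) (mc : VS.IsModularCut 𝔽 m E r 𝓜) where
  open VS 𝔽 m hiding (_+ᵥ_; _·ᵥ_; 0ᵥ)
  open Spans 𝔽 m
  open QMatroid 𝔽 _≟_ m E sE r qm
  open IsModularCut mc

  cl∈-from-member : ∀ {X F} → 𝓜 F → Sub X → X ⊆ F → r F ≤ r X → 𝓜 (cl E r X)
  cl∈-from-member {X} {F} F∈𝓜 sX X⊆F rF≤rX = upward F (cl E r X) F∈𝓜 (cl-isFlat sX) F⊆clX
    where
      sF = proj₁ (flats F F∈𝓜)
      F⊆clX : F ⊆ cl E r X
      F⊆clX v v∈F = ∈-cl sX v∈E (ℕP.≤-trans (rank-mono (⊕-sub sX (⟨⟩-sub v∈E)) sF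
                                               (⊕-least (proj₁ sF) X⊆F (⟨⟩-least (proj₁ sF) v∈F))) rF≤rX)
        where v∈E = proj₂ sF v v∈F

  cl∈-mono : ∀ {X Y} → 𝓜 (cl E r X) → Sub X → Sub Y → X ⊆ Y → 𝓜 (cl E r Y)
  cl∈-mono {X} {Y} clX∈𝓜 sX sY X⊆Y = upward _ _ clX∈𝓜 (cl-isFlat sY) (cl-mono sX sY X⊆Y)

  cl∈-∩ : ∀ {I₁ I₂} → Sub I₁ → Sub I₂ → 𝓜 (cl E r I₁) → 𝓜 (cl E r I₂) →
          IsModularPair r I₁ I₂ → 𝓜 (cl E r (I₁ ∩ I₂))
  cl∈-∩ {I₁} {I₂} s₁ s₂ F₁∈𝓜 F₂∈𝓜 modular-I =
    cl∈-from-member (modular F₁ F₂ F₁∈𝓜 F₂∈𝓜 modular-F) (∩-subˡ s₁ (proj₁ s₂))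
      (∩-mono (⊆-cl s₁) (⊆-cl s₂)) rF₁∩F₂≤rI₁∩I₂
    where
      F₁ = cl E r I₁
      F₂ = cl E r I₂
      sF₁ = cl-sub I₁
      sF₂ = cl-sub I₂
      ⊕≤ : r (I₁ ⊕ I₂) ≤ r (F₁ ⊕ F₂)
      ⊕≤ = rank-mono (⊕-sub s₁ s₂) (⊕-sub sF₁ sF₂) (⊕-mono (⊆-cl s₁) (⊆-cl s₂))
      ∩≤ : r (I₁ ∩ I₂) ≤ r (F₁ ∩ F₂)
      ∩≤ = rank-mono (∩-subˡ s₁ (proj₁ s₂)) (∩-subˡ sF₁ (proj₁ sF₂)) (∩-mono (⊆-cl s₁) (⊆-cl s₂))
      rF≡rI : r F₁ +ℕ r F₂ ≡ r (I₁ ⊕ I₂) +ℕ r (I₁ ∩ I₂)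
      rF≡rI = trans (cong₂ _+ℕ_ (rank-cl s₁) (rank-cl s₂)) (sym modular-I)
      modular-F : IsModularPair r F₁ F₂
      modular-F = ℕP.≤-antisym (submodular sF₁ sF₂)
                    (ℕP.≤-trans (ℕP.≤-reflexive rF≡rI) (ℕP.+-mono-≤ ⊕≤ ∩≤))
      rF₁∩F₂≤rI₁∩I₂ : r (F₁ ∩ F₂) ≤ r (I₁ ∩ I₂)
      rF₁∩F₂≤rI₁∩I₂ = ℕP.+-cancelˡ-≤ (r (I₁ ⊕ I₂)) _ _
        (ℕP.≤-trans (ℕP.+-monoˡ-≤ (r (F₁ ∩ F₂)) ⊕≤) (ℕP.≤-reflexive (trans modular-F rF≡rI)))

module Extension (𝔽 : FiniteField) (_≟_ : DecidableEquality (FiniteField.K 𝔽)) (n : ℕ) where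
  open VectorAlgebra 𝔽
  open VS 𝔽 (suc n) hiding (_+ᵥ_; _·ᵥ_; 0ᵥ)
  open Spans 𝔽 (suc n)
  open DecidableLinearAlgebra 𝔽 _≟_ (suc n) using (⊕⟨⟩-∩-⊆)
  open Classical

  module _ (E : Pred) (sE : IsSubspace E) (dimE : HasDim E n) (E? : ∀ v → Dec (E v))
           (r : Pred → ℕ) (qm : IsQMatroid E r)
           (μ : V → Pred → Set) (mcs : IsModularCutSelector E r μ)
           (rμ : Pred → ℕ) (rμ-cong : RespectsEq IsSubspace rμ)
           (rμ-inside : ∀ X → SubOf E X → rμ X ≡ r X)
           (rμ-outside : ∀ X e → SubOf E X → ¬ E e →
                           (μ e (cl E r X) → rμ (X ⊕ ⟨ e ⟩) ≡ r X)
                         × (¬ μ e (cl E r X) → rμ (X ⊕ ⟨ e ⟩) ≡ suc (r X))) where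
    open QMatroid 𝔽 _≟_ (suc n) E sE r qm
    open Hyperplane 𝔽 _≟_ n E sE dimE
    open IsModularCutSelector mcs
    module Cut {e} (e∉E : ¬ E e) = ModularCut 𝔽 _≟_ (suc n) E sE r qm (μ e) (cut e e∉E)
    open ℕP.≤-Reasoning

    data Delta (X : Pred) (e : V) : ℕ → Set where
      δ≡0 : μ e (cl E r X) → Delta X e 0
      δ≡1 : ¬ μ e (cl E r X) → Delta X e 1

    ¬¬-delta : ∀ X e → ¬ ¬ Σ ℕ (Delta X e)
    ¬¬-delta X e = ¬¬-map (λ { (yes c) → 0 , δ≡0 c ; (no ¬c) → 1 , δ≡1 ¬c }) ¬¬-excluded-middle

    rμ-delta : ∀ {X e δ} → Sub X → ¬ E e → Delta X e δ → rμ (X ⊕ ⟨ e ⟩) ≡ δ +ℕ r X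
    rμ-delta {X} {e} sX e∉E (δ≡0 c)  = proj₁ (rμ-outside X e sX e∉E) c
    rμ-delta {X} {e} sX e∉E (δ≡1 ¬c) = proj₂ (rμ-outside X e sX e∉E) ¬c

    rμ-⊕⟨⟩≤suc : ∀ {X e} → Sub X → ¬ E e → rμ (X ⊕ ⟨ e ⟩) ≤ suc (r X)
    rμ-⊕⟨⟩≤suc {X} {e} sX e∉E = ¬¬-elim-≤ (¬¬-delta X e) λ
      { (_ , δ≡0 c)  → ℕP.≤-trans (ℕP.≤-reflexive (rμ-delta sX e∉E (δ≡0 c))) (ℕP.n≤1+n _)
      ; (_ , δ≡1 ¬c) → ℕP.≤-reflexive (rμ-delta sX e∉E (δ≡1 ¬c)) }

    rμ-⊕⟨⟩≤ : ∀ {X Y e δ} → Sub X → Sub Y → X ⊆ Y → ¬ E e → Delta X e δ → rμ (Y ⊕ ⟨ e ⟩) ≤ δ +ℕ r Y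
    rμ-⊕⟨⟩≤ sX sY X⊆Y e∉E (δ≡0 c) =
      ℕP.≤-reflexive (rμ-delta sY e∉E (δ≡0 (Cut.cl∈-mono e∉E c sX sY X⊆Y)))
    rμ-⊕⟨⟩≤ sX sY X⊆Y e∉E (δ≡1 _) = rμ-⊕⟨⟩≤suc sY e∉E

    rμ-⊕-cong : ∀ {X Y X′ Y′} → (X ⊕ Y) ≐ (X′ ⊕ Y′) → rμ (X ⊕ Y) ≡ rμ (X′ ⊕ Y′)
    rμ-⊕-cong = rμ-cong _ _ (⊕-isSubspace _ _) (⊕-isSubspace _ _)

    ∩E-sub : ∀ {Z} → IsSubspace Z → Sub (Z ∩ E)
    ∩E-sub sZ = ∩-subʳ sZ E-sub

    rμ-split : ∀ {Z z δ} → IsSubspace Z → Z z → ¬ E z → Delta (Z ∩ E) z δ → rμ Z ≡ δ +ℕ r (Z ∩ E)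
    rμ-split sZ z∈Z z∉E Δ =
      trans (rμ-cong _ _ sZ (⊕-isSubspace _ _) (≐-∩⊕⟨⟩ sZ z∈Z z∉E)) (rμ-delta (∩E-sub sZ) z∉E Δ)

    rμ+rμ-split : ∀ {Z₁ Z₂ z₁ z₂ δ₁ δ₂} →
                  IsSubspace Z₁ → Z₁ z₁ → ¬ E z₁ → Delta (Z₁ ∩ E) z₁ δ₁ →
                  IsSubspace Z₂ → Z₂ z₂ → ¬ E z₂ → Delta (Z₂ ∩ E) z₂ δ₂ →
                  (δ₁ +ℕ δ₂) +ℕ (r (Z₁ ∩ E) +ℕ r (Z₂ ∩ E)) ≡ rμ Z₁ +ℕ rμ Z₂
    rμ+rμ-split {δ₁ = δ₁} {δ₂} sZ₁ z₁∈Z₁ z₁∉E Δ₁ sZ₂ z₂∈Z₂ z₂∉E Δ₂ =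
      trans (+-interchange δ₁ δ₂ _ _)
          (sym (cong₂ _+ℕ_ (rμ-split sZ₁ z₁∈Z₁ z₁∉E Δ₁) (rμ-split sZ₂ z₂∈Z₂ z₂∉E Δ₂)))

    Submodular : Pred → Pred → Set
    Submodular Z₁ Z₂ = rμ (Z₁ ⊕ Z₂) +ℕ rμ (Z₁ ∩ Z₂) ≤ rμ Z₁ +ℕ rμ Z₂

    submodular-inside : ∀ {Z₁ Z₂} → Sub Z₁ → Sub Z₂ → Submodular Z₁ Z₂
    submodular-inside {Z₁} {Z₂} s₁ s₂ = begin
      rμ (Z₁ ⊕ Z₂) +ℕ rμ (Z₁ ∩ Z₂)
        ≡⟨ cong₂ _+ℕ_ (rμ-inside _ (⊕-sub s₁ s₂)) (rμ-inside _ (∩-subˡ s₁ (proj₁ s₂))) ⟩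
      r (Z₁ ⊕ Z₂) +ℕ r (Z₁ ∩ Z₂)
        ≤⟨ submodular s₁ s₂ ⟩
      r Z₁ +ℕ r Z₂
        ≡⟨ cong₂ _+ℕ_ (rμ-inside _ s₁) (rμ-inside _ s₂) ⟨
      rμ Z₁ +ℕ rμ Z₂ ∎

    submodular-sym : ∀ {Z₁ Z₂} → IsSubspace Z₁ → IsSubspace Z₂ → Submodular Z₂ Z₁ → Submodular Z₁ Z₂
    submodular-sym {Z₁} {Z₂} sZ₁ sZ₂ sub₂₁ = begin
      rμ (Z₁ ⊕ Z₂) +ℕ rμ (Z₁ ∩ Z₂)
        ≡⟨ cong₂ _+ℕ_ (rμ-⊕-cong (⊕-comm Z₁ Z₂))
                      (rμ-cong _ _ (∩-isSubspace sZ₁ sZ₂) (∩-isSubspace sZ₂ sZ₁) (∩-comm Z₁ Z₂)) ⟩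
      rμ (Z₂ ⊕ Z₁) +ℕ rμ (Z₂ ∩ Z₁)
        ≤⟨ sub₂₁ ⟩
      rμ Z₂ +ℕ rμ Z₁
        ≡⟨ ℕP.+-comm (rμ Z₂) (rμ Z₁) ⟩
      rμ Z₁ +ℕ rμ Z₂ ∎

    submodular-one-outside : ∀ {Z₁ Z₂ z} → IsSubspace Z₁ → Sub Z₂ → Z₁ z → ¬ E z → Submodular Z₁ Z₂
    submodular-one-outside {Z₁} {Z₂} {z} sZ₁ s₂ z∈Z₁ z∉E = ¬¬-elim-≤ (¬¬-delta I₁ z) λ (δ , Δ) → begin
      rμ (Z₁ ⊕ Z₂) +ℕ rμ (Z₁ ∩ Z₂)  ≡⟨ cong₂ _+ℕ_ (rμ-⊕-cong sum≐) rμ-∩ ⟩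
      rμ (W ⊕ ⟨ z ⟩) +ℕ r (I₁ ∩ Z₂) ≤⟨ ℕP.+-monoˡ-≤ _ (rμ-⊕⟨⟩≤ sI₁ sW ⊆-⊕ˡ z∉E Δ) ⟩
      (δ +ℕ r W) +ℕ r (I₁ ∩ Z₂)     ≡⟨ ℕP.+-assoc δ _ _ ⟩
      δ +ℕ (r W +ℕ r (I₁ ∩ Z₂))     ≤⟨ ℕP.+-monoʳ-≤ δ (submodular sI₁ s₂) ⟩
      δ +ℕ (r I₁ +ℕ r Z₂)           ≡⟨ ℕP.+-assoc δ _ _ ⟨
      (δ +ℕ r I₁) +ℕ r Z₂           ≡⟨ cong₂ _+ℕ_ (rμ-split sZ₁ z∈Z₁ z∉E Δ) (rμ-inside _ s₂) ⟨
      rμ Z₁ +ℕ rμ Z₂                ∎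
      where
        I₁ = Z₁ ∩ E
        sI₁ = ∩E-sub sZ₁
        W = I₁ ⊕ Z₂
        sW = ⊕-sub sI₁ s₂
        sum≐ : (Z₁ ⊕ Z₂) ≐ (W ⊕ ⟨ z ⟩)
        sum≐ = ⊕-least (⊕-isSubspace _ _)
                 (⊆-trans (proj₁ (≐-∩⊕⟨⟩ sZ₁ z∈Z₁ z∉E)) (⊕-mono ⊆-⊕ˡ ⊆-refl)) (⊆-trans ⊆-⊕ʳ ⊆-⊕ˡ)
             , ⊕-least (⊕-isSubspace _ _)
                 (⊕-mono (λ _ → proj₁) ⊆-refl) (⟨⟩-least (⊕-isSubspace _ _) (⊆-⊕ˡ z z∈Z₁))
        rμ-∩ : rμ (Z₁ ∩ Z₂) ≡ r (I₁ ∩ Z₂)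
        rμ-∩ = trans (rμ-inside _ (∩-subʳ sZ₁ s₂)) (rank-cong (∩-subʳ sZ₁ s₂) (∩-subˡ sI₁ (proj₁ s₂))
                 ( (λ v (v∈Z₁ , v∈Z₂) → (v∈Z₁ , proj₂ s₂ v v∈Z₂) , v∈Z₂)
                 , (λ v ((v∈Z₁ , _) , v∈Z₂) → v∈Z₁ , v∈Z₂)))

    submodular-common-outside : ∀ {Z₁ Z₂ e} → IsSubspace Z₁ → IsSubspace Z₂ → Z₁ e → Z₂ e → ¬ E e →
                                Submodular Z₁ Z₂
    submodular-common-outside {Z₁} {Z₂} {e} sZ₁ sZ₂ e∈Z₁ e∈Z₂ e∉E =
      ¬¬-elim-≤ (¬¬-delta I₁ e) λ (δ₁ , Δ₁) → ¬¬-elim-≤ (¬¬-delta I₂ e) λ (δ₂ , Δ₂) → begin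
        rμ (Z₁ ⊕ Z₂) +ℕ rμ (Z₁ ∩ Z₂)
          ≡⟨ cong₂ _+ℕ_ (rμ-⊕-cong sum≐) (rμ-cong _ _ (∩-isSubspace sZ₁ sZ₂) (⊕-isSubspace _ _) ∩≐) ⟩
        rμ (S ⊕ ⟨ e ⟩) +ℕ rμ (I₁₂ ⊕ ⟨ e ⟩)
          ≤⟨ bound Δ₁ Δ₂ ⟩
        (δ₁ +ℕ δ₂) +ℕ (r I₁ +ℕ r I₂)
          ≡⟨ rμ+rμ-split sZ₁ e∈Z₁ e∉E Δ₁ sZ₂ e∈Z₂ e∉E Δ₂ ⟩
        rμ Z₁ +ℕ rμ Z₂ ∎
      where
        I₁ = Z₁ ∩ E
        I₂ = Z₂ ∩ E
        sI₁ = ∩E-sub sZ₁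
        sI₂ = ∩E-sub sZ₂
        S = I₁ ⊕ I₂
        sS = ⊕-sub sI₁ sI₂
        I₁₂ = I₁ ∩ I₂
        sI₁₂ = ∩-subˡ sI₁ (proj₁ sI₂)
        sum≐ : (Z₁ ⊕ Z₂) ≐ (S ⊕ ⟨ e ⟩)
        sum≐ = ⊕-least (⊕-isSubspace _ _)
                 (⊆-trans (proj₁ (≐-∩⊕⟨⟩ sZ₁ e∈Z₁ e∉E)) (⊕-mono ⊆-⊕ˡ ⊆-refl))
                 (⊆-trans (proj₁ (≐-∩⊕⟨⟩ sZ₂ e∈Z₂ e∉E)) (⊕-mono ⊆-⊕ʳ ⊆-refl))
             , ⊕-least (⊕-isSubspace _ _)
                 (⊕-mono (λ _ → proj₁) (λ _ → proj₁)) (⟨⟩-least (⊕-isSubspace _ _) (⊆-⊕ˡ e e∈Z₁))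
        ∩≐ : (Z₁ ∩ Z₂) ≐ (I₁₂ ⊕ ⟨ e ⟩)
        ∩≐ = ≐-trans (≐-∩⊕⟨⟩ (∩-isSubspace sZ₁ sZ₂) (e∈Z₁ , e∈Z₂) e∉E)
                     (⊕-congˡ ( (λ v ((v∈Z₁ , v∈Z₂) , v∈E) → (v∈Z₁ , v∈E) , (v∈Z₂ , v∈E))
                              , (λ v ((v∈Z₁ , v∈E) , (v∈Z₂ , _)) → (v∈Z₁ , v∈Z₂) , v∈E)))
        -- If μ e contains cl I₁ and cl I₂, then either I₁, I₂ is a modular pair and μ e also
        -- contains cl (I₁ ∩ I₂), or submodularity of r holds strictly and absorbs δ_{I₁∩I₂,e} = 1.
        bound : ∀ {δ₁ δ₂} → Delta I₁ e δ₁ → Delta I₂ e δ₂ →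
                rμ (S ⊕ ⟨ e ⟩) +ℕ rμ (I₁₂ ⊕ ⟨ e ⟩) ≤ (δ₁ +ℕ δ₂) +ℕ (r I₁ +ℕ r I₂)
        bound (δ≡0 c₁) (δ≡0 c₂) with r S +ℕ r I₁₂ ℕ.≟ r I₁ +ℕ r I₂
        ... | yes modular =
          +-mono-≤-shifted 0 0 (rμ-⊕⟨⟩≤ sI₁ sS ⊆-⊕ˡ e∉E (δ≡0 c₁))
            (rμ-⊕⟨⟩≤ sI₁₂ sI₁₂ ⊆-refl e∉E (δ≡0 (Cut.cl∈-∩ e∉E sI₁ sI₂ c₁ c₂ modular)))
            (submodular sI₁ sI₂)
        ... | no ¬modular = ℕP.≤-trans
          (+-mono-≤-shifted 0 1 (rμ-⊕⟨⟩≤ sI₁ sS ⊆-⊕ˡ e∉E (δ≡0 c₁)) (rμ-⊕⟨⟩≤suc sI₁₂ e∉E) ℕP.≤-refl)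
          (ℕP.≤∧≢⇒< (submodular sI₁ sI₂) ¬modular)
        bound (δ≡0 c₁) (δ≡1 _) =
          +-mono-≤-shifted 0 1 (rμ-⊕⟨⟩≤ sI₁ sS ⊆-⊕ˡ e∉E (δ≡0 c₁)) (rμ-⊕⟨⟩≤suc sI₁₂ e∉E)
            (submodular sI₁ sI₂)
        bound (δ≡1 _) (δ≡0 c₂) =
          +-mono-≤-shifted 0 1 (rμ-⊕⟨⟩≤ sI₂ sS ⊆-⊕ʳ e∉E (δ≡0 c₂)) (rμ-⊕⟨⟩≤suc sI₁₂ e∉E)
            (submodular sI₁ sI₂)
        bound (δ≡1 _) (δ≡1 _) =
          +-mono-≤-shifted 1 1 (rμ-⊕⟨⟩≤suc sS e∉E) (rμ-⊕⟨⟩≤suc sI₁₂ e∉E) (submodular sI₁ sI₂)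

    module TwoOutside {Za Zb a b} (sZa : IsSubspace Za) (sZb : IsSubspace Zb)
                      (a∈Za : Za a) (a∉E : ¬ E a) (b∈Zb : Zb b) (b∉E : ¬ E b) where
      A = Za ∩ E
      B = Zb ∩ E
      sA = ∩E-sub sZa
      sB = ∩E-sub sZb
      W = A ⊕ B
      sW = ⊕-sub sA sB

      -- b = y + c·a with y ∈ E, so that Za ⊕ Zb = (W ⊕ ⟨y⟩) ⊕ ⟨a⟩ and W ⊕ ⟨y⟩ ⊆ E.
      y = proj₁ (hyperplane-split a∉E b)
      c = proj₁ (proj₂ (hyperplane-split a∉E b))
      y∈E = proj₁ (proj₂ (proj₂ (hyperplane-split a∉E b)))
      b≡y+c·a = proj₂ (proj₂ (proj₂ (hyperplane-split a∉E b)))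

      Y = W ⊕ ⟨ y ⟩
      sY = ⊕-sub sW (⟨⟩-sub y∈E)

      y∈ : ∀ {P} → IsSubspace P → P b → P a → P y
      y∈ {P} sP b∈P a∈P =
        subst P (+ᵥ-cancelʳ y (c ·ᵥ a)) (-ᵥ-closed sP (subst P b≡y+c·a b∈P) (proj₂ (proj₂ sP) c a a∈P))

      b∈Y⊕a : (Y ⊕ ⟨ a ⟩) b
      b∈Y⊕a = subst (Y ⊕ ⟨ a ⟩) (sym b≡y+c·a)
                (+ᵥ·ᵥ-closed (⊕-isSubspace _ _) c (⊆-⊕ˡ y (⊆-⊕ʳ y (∈⟨⟩ y))) (⊆-⊕ʳ a (∈⟨⟩ a)))

      rμ-sum : rμ (Za ⊕ Zb) ≡ rμ (Y ⊕ ⟨ a ⟩)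
      rμ-sum = rμ-⊕-cong
        ( ⊕-least (⊕-isSubspace _ _)
            (⊆-trans (proj₁ (≐-∩⊕⟨⟩ sZa a∈Za a∉E)) (⊕-mono (⊆-trans ⊆-⊕ˡ ⊆-⊕ˡ) ⊆-refl))
            (⊆-trans (proj₁ (≐-∩⊕⟨⟩ sZb b∈Zb b∉E))
               (⊕-least (⊕-isSubspace _ _) (⊆-trans (⊆-trans ⊆-⊕ʳ ⊆-⊕ˡ) ⊆-⊕ˡ)
                                           (⟨⟩-least (⊕-isSubspace _ _) b∈Y⊕a)))
        , ⊕-least (⊕-isSubspace _ _)
            (⊕-least (⊕-isSubspace _ _) (⊕-mono (λ _ → proj₁) (λ _ → proj₁))
               (⟨⟩-least (⊕-isSubspace _ _) (y∈ (⊕-isSubspace _ _) (⊆-⊕ʳ b b∈Zb) (⊆-⊕ˡ a a∈Za))))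
            (⟨⟩-least (⊕-isSubspace _ _) (⊆-⊕ˡ a a∈Za)) )

      -- Both cuts contain F = cl W, so the selector gives F ⊕ ⟨a⟩ = F ⊕ ⟨b⟩ ∋ y, whence y ∈ F.
      rank-Y≤ : μ a (cl E r A) → μ b (cl E r B) → r Y ≤ r W
      rank-Y≤ ca cb = ℕP.≤-trans (rank-mono sY (cl-sub W) Y⊆F) (rank-cl≤ sW)
        where
          F = cl E r W
          F⊕a≐F⊕b : (F ⊕ ⟨ a ⟩) ≐ (F ⊕ ⟨ b ⟩)
          F⊕a≐F⊕b = proj₂ (sel a b a∉E b∉E F (Cut.cl∈-mono a∉E ca sA sW ⊆-⊕ˡ))
                          (Cut.cl∈-mono b∉E cb sB sW ⊆-⊕ʳ)
          y∈F⊕a : (F ⊕ ⟨ a ⟩) y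
          y∈F⊕a = y∈ (⊕-isSubspace _ _) (proj₂ F⊕a≐F⊕b b (⊆-⊕ʳ b (∈⟨⟩ b))) (⊆-⊕ʳ a (∈⟨⟩ a))
          Y⊆F : Y ⊆ F
          Y⊆F = ⊕-least (proj₁ (cl-sub W)) (⊆-cl sW)
                  (⟨⟩-least (proj₁ (cl-sub W)) (⊕⟨⟩-∩-⊆ sE (cl-sub W) a∉E y (y∈F⊕a , y∈E)))

      rμ-sum≤ : ∀ {δ} → μ a (cl E r A) → Delta B b δ → rμ (Za ⊕ Zb) ≤ δ +ℕ r W
      rμ-sum≤ {δ} ca Δ = begin
        rμ (Za ⊕ Zb)    ≡⟨ rμ-sum ⟩
        rμ (Y ⊕ ⟨ a ⟩)  ≡⟨ rμ-delta sY a∉E (δ≡0 (Cut.cl∈-mono a∉E ca sA sY (⊆-trans ⊆-⊕ˡ ⊆-⊕ˡ))) ⟩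
        r Y             ≤⟨ rank-Y≤-δ Δ ⟩
        δ +ℕ r W        ∎
        where
          rank-Y≤-δ : ∀ {δ} → Delta B b δ → r Y ≤ δ +ℕ r W
          rank-Y≤-δ (δ≡0 cb) = rank-Y≤ ca cb
          rank-Y≤-δ (δ≡1 _)  = rank-⊕⟨⟩≤suc sW y∈E

      rμ-sum≤2 : rμ (Za ⊕ Zb) ≤ 2 +ℕ r W
      rμ-sum≤2 = begin
        rμ (Za ⊕ Zb)    ≡⟨ rμ-sum ⟩
        rμ (Y ⊕ ⟨ a ⟩)  ≤⟨ rμ-⊕⟨⟩≤suc sY a∉E ⟩
        suc (r Y)       ≤⟨ s≤s (rank-⊕⟨⟩≤suc sW y∈E) ⟩
        2 +ℕ r W        ∎

    rμ-⊕≤ : ∀ {Za Zb a b δa δb} → IsSubspace Za → IsSubspace Zb → Za a → ¬ E a → Zb b → ¬ E b →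
            Delta (Za ∩ E) a δa → Delta (Zb ∩ E) b δb →
            rμ (Za ⊕ Zb) ≤ (δa +ℕ δb) +ℕ r ((Za ∩ E) ⊕ (Zb ∩ E))
    rμ-⊕≤ sZa sZb a∈Za a∉E b∈Zb b∉E (δ≡0 ca) Δb =
      TwoOutside.rμ-sum≤ sZa sZb a∈Za a∉E b∈Zb b∉E ca Δb
    rμ-⊕≤ {Za} {Zb} sZa sZb a∈Za a∉E b∈Zb b∉E (δ≡1 ¬ca) (δ≡0 cb) =
      subst₂ (λ u w → u ≤ 1 +ℕ w)
        (rμ-⊕-cong (⊕-comm Zb Za))
        (rank-cong (⊕-sub (∩E-sub sZb) (∩E-sub sZa)) (⊕-sub (∩E-sub sZa) (∩E-sub sZb)) (⊕-comm _ _))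
        (TwoOutside.rμ-sum≤ sZb sZa b∈Zb b∉E a∈Za a∉E cb (δ≡1 ¬ca))
    rμ-⊕≤ sZa sZb a∈Za a∉E b∈Zb b∉E (δ≡1 _) (δ≡1 _) =
      TwoOutside.rμ-sum≤2 sZa sZb a∈Za a∉E b∈Zb b∉E

    submodular-apart : ∀ {Z₁ Z₂ z₁ z₂} → IsSubspace Z₁ → IsSubspace Z₂ → Z₁ z₁ → ¬ E z₁ → Z₂ z₂ → ¬ E z₂ →
                       (Z₁ ∩ Z₂) ⊆ E → Submodular Z₁ Z₂
    submodular-apart {Z₁} {Z₂} {z₁} {z₂} sZ₁ sZ₂ z₁∈Z₁ z₁∉E z₂∈Z₂ z₂∉E Z₁∩Z₂⊆E =
      ¬¬-elim-≤ (¬¬-delta I₁ z₁) λ (δ₁ , Δ₁) → ¬¬-elim-≤ (¬¬-delta I₂ z₂) λ (δ₂ , Δ₂) → begin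
        rμ (Z₁ ⊕ Z₂) +ℕ rμ (Z₁ ∩ Z₂)
          ≡⟨ cong (rμ (Z₁ ⊕ Z₂) +ℕ_) rμ-∩ ⟩
        rμ (Z₁ ⊕ Z₂) +ℕ r (I₁ ∩ I₂)
          ≤⟨ ℕP.+-monoˡ-≤ _ (rμ-⊕≤ sZ₁ sZ₂ z₁∈Z₁ z₁∉E z₂∈Z₂ z₂∉E Δ₁ Δ₂) ⟩
        ((δ₁ +ℕ δ₂) +ℕ r (I₁ ⊕ I₂)) +ℕ r (I₁ ∩ I₂)
          ≡⟨ ℕP.+-assoc (δ₁ +ℕ δ₂) _ _ ⟩
        (δ₁ +ℕ δ₂) +ℕ (r (I₁ ⊕ I₂) +ℕ r (I₁ ∩ I₂))
          ≤⟨ ℕP.+-monoʳ-≤ (δ₁ +ℕ δ₂) (submodular sI₁ sI₂) ⟩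
        (δ₁ +ℕ δ₂) +ℕ (r I₁ +ℕ r I₂)
          ≡⟨ rμ+rμ-split sZ₁ z₁∈Z₁ z₁∉E Δ₁ sZ₂ z₂∈Z₂ z₂∉E Δ₂ ⟩
        rμ Z₁ +ℕ rμ Z₂ ∎
      where
        I₁ = Z₁ ∩ E
        I₂ = Z₂ ∩ E
        sI₁ = ∩E-sub sZ₁
        sI₂ = ∩E-sub sZ₂
        sZ₁₂ : Sub (Z₁ ∩ Z₂)
        sZ₁₂ = ∩-isSubspace sZ₁ sZ₂ , Z₁∩Z₂⊆E
        rμ-∩ : rμ (Z₁ ∩ Z₂) ≡ r (I₁ ∩ I₂)
        rμ-∩ = trans (rμ-inside _ sZ₁₂) (rank-cong sZ₁₂ (∩-subˡ sI₁ (proj₁ sI₂))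
                 ( (λ v v∈ → (proj₁ v∈ , Z₁∩Z₂⊆E v v∈) , (proj₂ v∈ , Z₁∩Z₂⊆E v v∈))
                 , (λ v ((v∈Z₁ , _) , (v∈Z₂ , _)) → v∈Z₁ , v∈Z₂)))

    Outside : Pred → Set
    Outside Z = Σ V λ z → Z z × ¬ E z

    sub-if-¬outside : ∀ {Z} → IsSubspace Z → ¬ Outside Z → Sub Z
    sub-if-¬outside sZ ¬out = sZ , λ v v∈Z → decidable-stable (E? v) (λ v∉E → ¬out (v , v∈Z , v∉E))

    submodular-rμ : ∀ {Z₁ Z₂} → IsSubspace Z₁ → IsSubspace Z₂ → Submodular Z₁ Z₂
    submodular-rμ {Z₁} {Z₂} sZ₁ sZ₂ =
      by-cases {A = Outside (Z₁ ∩ Z₂)}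
        (λ (e , (e∈Z₁ , e∈Z₂) , e∉E) → submodular-common-outside sZ₁ sZ₂ e∈Z₁ e∈Z₂ e∉E)
        λ ¬out₁₂ → by-cases {A = Outside Z₁}
          (λ (z₁ , z₁∈Z₁ , z₁∉E) → by-cases {A = Outside Z₂}
             (λ (z₂ , z₂∈Z₂ , z₂∉E) → submodular-apart sZ₁ sZ₂ z₁∈Z₁ z₁∉E z₂∈Z₂ z₂∉E
                                         (proj₂ (sub-if-¬outside (∩-isSubspace sZ₁ sZ₂) ¬out₁₂)))
             (λ ¬out₂ → submodular-one-outside sZ₁ (sub-if-¬outside sZ₂ ¬out₂) z₁∈Z₁ z₁∉E))
          λ ¬out₁ → by-cases {A = Outside Z₂}
             (λ (z₂ , z₂∈Z₂ , z₂∉E) → submodular-sym sZ₁ sZ₂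
                (submodular-one-outside sZ₂ (sub-if-¬outside sZ₁ ¬out₁) z₂∈Z₂ z₂∉E))
             (λ ¬out₂ → submodular-inside (sub-if-¬outside sZ₁ ¬out₁) (sub-if-¬outside sZ₂ ¬out₂))

open import Data.Nat using (_+_)

lemma3p9 : (𝔽 : FiniteField) (n : ℕ) →
    let open VS 𝔽 (suc n) in
    (E : Pred) → IsSubspace E → HasDim E n →
    (r : Pred → ℕ) → IsQMatroid E r →
    (μ : V → Pred → Set) → IsModularCutSelector E r μ →
    (rμ : Pred → ℕ) → RespectsEq IsSubspace rμ →
    (∀ X → SubOf E X → rμ X ≡ r X) →
    (∀ X e → SubOf E X → ¬ E e →
        (μ e (cl E r X) → rμ (X ⊕ ⟨ e ⟩) ≡ r X)
      × (¬ μ e (cl E r X) → rμ (X ⊕ ⟨ e ⟩) ≡ suc (r X))) →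
    ∀ Z₁ Z₂ → IsSubspace Z₁ → IsSubspace Z₂ →
    rμ (Z₁ ⊕ Z₂) + rμ (Z₁ ∩ Z₂) ≤ rμ Z₁ + rμ Z₂
lemma3p9 𝔽 n E sE dimE r qm μ mcs rμ rμ-cong rμ-inside rμ-outside Z₁ Z₂ sZ₁ sZ₂ =
  ¬¬-elim-≤ ¬¬-decidableEquality λ _≟_ →
  ¬¬-elim-≤ (¬¬-∀ᵥ (suc n) (λ _ → ¬¬-excluded-middle)) λ E? →
  Extension.submodular-rμ 𝔽 _≟_ n E sE dimE E? r qm μ mcs rμ rμ-cong rμ-inside rμ-outside sZ₁ sZ₂
  where open Classical
        open Enumeration 𝔽
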